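{- Let $n\ge 2$ and $k\ge 3$ be integers. Set $X=\{2j : 0\le j<n\}$, $m=2(k+1)n-2$, $Y=m-X=\{m-x : x\in X\}$, $Z=\{2jn-1 : 1\le j\le k\}$, $B=X\sqcup Y\sqcup Z$, $a^*=2n$, $A^*=B\sqcup\{a^*\}$, $a=m+2$, and $A=A^*\sqcup\{a\}$. Then $|A^*+A^*|>|A^*-A^*|$ and $|A+A|>|A-A|$; more precisely $|A^*+A^*|-|A^*-A^*|=|A+A|-|A-A|=1$.
   Context: For $A\subseteq\mathbb{Z}$, $A+A=\{a_1+a_2 : a_1,a_2\in A\}$ and $A-A=\{a_1-a_2 : a_1,a_2\in A\}$. -}

module Defs where

open import Data.Nat as ℕ using (ℕ)
open import Data.Integer using (ℤ; +_; _+_; _-_; _*_; _≟_)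
open import Data.List using (List; []; _∷_; _++_; map; length; upTo; deduplicate; cartesianProductWith)

-- Finite sets of integers are represented by lists (repetitions allowed);
-- the cardinality of the underlying set is the number of distinct entries.
∣_∣ : List ℤ → ℕ
∣ xs ∣ = length (deduplicate _≟_ xs)

_⊕_ : List ℤ → List ℤ → List ℤ
xs ⊕ ys = cartesianProductWith _+_ xs ys

_⊖_ : List ℤ → List ℤ → List ℤ
xs ⊖ ys = cartesianProductWith _-_ xs ys

Xset : ℕ → List ℤ
Xset n = map (λ j → + 2 * + j) (upTo n)

mval : ℕ → ℕ → ℤ
mval n k = + 2 * + (ℕ.suc k) * + n - + 2

Yset : ℕ → ℕ → List ℤ
Yset n k = map (λ x → mval n k - x) (Xset n)

Zset : ℕ → ℕ → List ℤ
Zset n k = map (λ i → + 2 * + (ℕ.suc i) * + n - + 1) (upTo k)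

Bset : ℕ → ℕ → List ℤ
Bset n k = Xset n ++ Yset n k ++ Zset n k

Astar : ℕ → ℕ → List ℤ
Astar n k = Bset n k ++ (+ 2 * + n ∷ [])

Aset : ℕ → ℕ → List ℤ
Aset n k = Astar n k ++ (mval n k + + 2 ∷ [])

-- Every element of A is 2h with h ∈ E = [0, n] ∪ [kn, kn + n - 1 + b] or 2h + 1 with
-- h ∈ O = {jn - 1 : 1 ≤ j ≤ k}, where b = 0 for A* and b = 1 for A.  Hence
-- A + A = 2((E + E) ∪ (O + O + 1)) ∪ (2(E + O) + 1) and A - A = {0} ∪ ±(2P ∪ (2Q + 1)), where
-- P = ((E - E) ∪ (O - O)) ∩ ℕ⁺ and Q = {d ≥ 0 : d + 1 ∈ E - O or d ∈ O - E}.  As consecutive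
-- elements of O are n apart, each of these sets is an explicit union of intervals and progressions
-- of step n, and counting gives |A + A| = 2kn + 6n + 2k - 4 + 4b and |A - A| = |A + A| - 1.

module Submission where

open import Data.Integer as ℤ using (ℤ; +_)
import Data.Integer.Properties as ℤP
import Data.Integer.Tactic.RingSolver as ℤ-Solver
open import Data.List using (List; []; _∷_; _++_; map; length; upTo)
open import Data.List.Properties using (length-++; length-map; length-upTo)
open import Data.List.Membership.Propositional using (_∈_)
open import Data.List.Membership.Propositional.Properties
open import Data.List.Relation.Binary.Disjoint.Propositional using (Disjoint)
open import Data.List.Relation.Binary.Subset.Propositional using (_⊆_)
open import Data.List.Relation.Unary.All as All using (All)
import Data.List.Relation.Unary.All.Properties as All
open import Data.List.Relation.Unary.AllPairs using (_∷_)
open import Data.List.Relation.Unary.Any using (here; there)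
open import Data.List.Relation.Unary.Unique.Propositional using (Unique)
import Data.List.Relation.Unary.Unique.Propositional.Properties as Unique
open import Data.List.Relation.Unary.Unique.DecPropositional.Properties using (deduplicate-!)
open import Data.Nat using (ℕ; zero; suc; _+_; _*_; _≤_; _<_; z≤n; s≤s; compare; less; equal; greater)
open import Data.Nat.DivMod using (_/_; _%_; m≡m%n+[m/n]*n; m%n<n)
open import Data.Nat.Properties
  using (1+n≢0; +-suc; +-comm; +-identityʳ; +-cancelʳ-≡; +-cancelˡ-≡; *-cancelʳ-≡; *-cancelˡ-≡; suc-injective;
         m≤m+n; ≤-trans; ≤-antisym; <⇒≱; m≤n⇒∃[o]m+o≡n; m+n≡0⇒m≡0; m+n≡0⇒n≡0; even≢odd)
open import Data.Nat.Tactic.RingSolver using (solve)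
open import Data.Product using (∃; ∃₂; _×_; _,_; proj₁; proj₂)
open import Data.Sum using (_⊎_; inj₁; inj₂)
open import Data.Empty using (⊥-elim)
open import Function.Base using (case_of_)
open import Relation.Binary.PropositionalEquality using (_≡_; _≢_; refl; sym; trans; cong; cong₂; subst; module ≡-Reasoning)

open import Defs

module _ {A : Set} where

  ∈-++-∷⁻ : ∀ {x y : A} ys {zs} → y ∈ ys ++ x ∷ zs → y ≢ x → y ∈ ys ++ zs
  ∈-++-∷⁻ []       (here y≡x)   y≢x = ⊥-elim (y≢x y≡x)
  ∈-++-∷⁻ []       (there y∈zs) y≢x = y∈zs
  ∈-++-∷⁻ (_ ∷ ys) (here refl)  y≢x = here refl
  ∈-++-∷⁻ (_ ∷ ys) (there y∈)   y≢x = there (∈-++-∷⁻ ys y∈ y≢x)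

  Unique-⊆⇒length≤ : ∀ {xs ys : List A} → Unique xs → xs ⊆ ys → length xs ≤ length ys
  Unique-⊆⇒length≤ {[]}     _              _  = z≤n
  Unique-⊆⇒length≤ {x ∷ xs} (x∉xs ∷ uniq) xs⊆ys
    with ys₁ , ys₂ , refl ← ∈-∃++ (xs⊆ys (here refl)) =
    subst (suc (length xs) ≤_) (sym length-removed)
      (s≤s (Unique-⊆⇒length≤ uniq λ z∈xs → ∈-++-∷⁻ ys₁ (xs⊆ys (there z∈xs)) (z≢x z∈xs)))
    where
    z≢x : ∀ {z} → z ∈ xs → z ≢ x
    z≢x z∈xs z≡x = All.lookup x∉xs z∈xs (sym z≡x)
    length-removed : length (ys₁ ++ x ∷ ys₂) ≡ suc (length (ys₁ ++ ys₂))
    length-removed = trans (length-++ ys₁) (trans (+-suc (length ys₁) (length ys₂)) (cong suc (sym (length-++ ys₁))))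

∣∣≡length : ∀ {xs ys : List ℤ} → Unique ys → xs ⊆ ys → ys ⊆ xs → ∣ xs ∣ ≡ length ys
∣∣≡length {xs} {ys} uniq xs⊆ys ys⊆xs = ≤-antisym
  (Unique-⊆⇒length≤ (deduplicate-! ℤ._≟_ xs) (λ z∈ → xs⊆ys (∈-deduplicate⁻ ℤ._≟_ xs z∈)))
  (Unique-⊆⇒length≤ uniq (λ z∈ys → ∈-deduplicate⁺ ℤ._≟_ (ys⊆xs z∈ys)))

-- To get A ≡ B from a hypothesis a ≡ b it suffices that A + b ≡ B + a, which is then usually
-- a semiring identity for the ring solver.
via : ∀ {A B a b : ℕ} → a ≡ b → A + b ≡ B + a → A ≡ B
via {A} {B} {a} a≡b eq = +-cancelʳ-≡ a A B (trans (cong (λ z → A + z) a≡b) eq)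

≤-by : ∀ {a b} d → a + d ≡ b → a ≤ b
≤-by {a} d refl = m≤m+n a d

<-by : ∀ {a b} d → suc a + d ≡ b → a < b
<-by = ≤-by

≤⊎> : ∀ a b → (∃ λ d → a + d ≡ b) ⊎ (∃ λ d → a ≡ b + suc d)
≤⊎> zero    b       = inj₁ (b , refl)
≤⊎> (suc a) zero    = inj₂ (a , refl)
≤⊎> (suc a) (suc b) with ≤⊎> a b
... | inj₁ (d , eq) = inj₁ (d , cong suc eq)
... | inj₂ (d , eq) = inj₂ (d , cong suc eq)

even+even : ∀ h h' → 2 * h + 2 * h' ≡ 2 * (h + h')
even+even h h' = solve (h ∷ h' ∷ [])

even+odd : ∀ h h' → 2 * h + suc (2 * h') ≡ suc (2 * (h + h'))
even+odd h h' = solve (h ∷ h' ∷ [])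

odd+even : ∀ h h' → suc (2 * h) + 2 * h' ≡ suc (2 * (h' + h))
odd+even h h' = solve (h ∷ h' ∷ [])

odd+odd : ∀ h h' → suc (2 * h) + suc (2 * h') ≡ 2 * suc (h + h')
odd+odd h h' = solve (h ∷ h' ∷ [])

interval : ℕ → ℕ → List ℕ
interval s c = map (λ t → s + t) (upTo c)

∈-interval⁺ : ∀ s c {w} t d → w ≡ s + t → suc t + d ≡ c → w ∈ interval s c
∈-interval⁺ s c t d refl eq = ∈-map⁺ (λ t → s + t) (∈-upTo⁺ (<-by d eq))

∈-interval⁻ : ∀ s c {w} → w ∈ interval s c → ∃₂ λ t d → w ≡ s + t × suc t + d ≡ c
∈-interval⁻ s c w∈ with t , t∈ , refl ← ∈-map⁻ (λ t → s + t) w∈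
                   with d , eq ← m≤n⇒∃[o]m+o≡n (∈-upTo⁻ t∈) = t , d , refl , eq

interval-unique : ∀ s c → Unique (interval s c)
interval-unique s c = Unique.map⁺ (+-cancelˡ-≡ s _ _) (Unique.upTo⁺ c)

length-interval : ∀ s c → length (interval s c) ≡ c
length-interval s c = trans (length-map (λ t → s + t) (upTo c)) (length-upTo c)

interval-≥ : ∀ s c → All (s ≤_) (interval s c)
interval-≥ s c = All.tabulate lower
  where
  lower : ∀ {w} → w ∈ interval s c → s ≤ w
  lower w∈ with t , _ , refl , _ ← ∈-interval⁻ s c w∈ = m≤m+n s t

interval-< : ∀ s c → All (_< s + c) (interval s c)
interval-< s c = All.tabulate upper
  where
  upper : ∀ {w} → w ∈ interval s c → w < s + c
  upper w∈ with t , d , refl , t<c ← ∈-interval⁻ s c w∈ =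
    <-by {s + t} {s + c} d (via t<c (solve (s ∷ c ∷ t ∷ d ∷ [])))

UniqueAbove : ℕ → List ℕ → Set
UniqueAbove lo xs = Unique xs × All (lo ≤_) xs

interval-UniqueAbove : ∀ s c → UniqueAbove s (interval s c)
interval-UniqueAbove s c = interval-unique s c , interval-≥ s c

UniqueAbove-++ : ∀ {lo hi xs ys} → lo ≤ hi → UniqueAbove lo xs → All (_< hi) xs → UniqueAbove hi ys →
                 UniqueAbove lo (xs ++ ys)
UniqueAbove-++ lo≤hi (uxs , lo≤xs) xs<hi (uys , hi≤ys) =
  Unique.++⁺ uxs uys (λ (x∈xs , x∈ys) → <⇒≱ (All.lookup xs<hi x∈xs) (All.lookup hi≤ys x∈ys)) ,
  All.++⁺ lo≤xs (All.map (≤-trans lo≤hi) hi≤ys)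

All<-weaken : ∀ {a b xs} → a ≤ b → All (_< a) xs → All (_< b) xs
All<-weaken a≤b = All.map (λ x<a → ≤-trans x<a a≤b)

length-++-≡ : ∀ (xs : List ℕ) {ys a b} → length xs ≡ a → length ys ≡ b → length (xs ++ ys) ≡ a + b
length-++-≡ xs lx ly = trans (length-++ xs) (cong₂ _+_ lx ly)

length-map-interval : ∀ (f : ℕ → ℕ) s c → length (map f (interval s c)) ≡ c
length-map-interval f s c = trans (length-map f (interval s c)) (length-interval s c)

parityUnion : List ℕ → List ℕ → List ℕ
parityUnion E O = map (2 *_) E ++ map (λ h → suc (2 * h)) O

∈-parityUnion-even : ∀ {h} E O → h ∈ E → 2 * h ∈ parityUnion E O
∈-parityUnion-even E O h∈E = ∈-++⁺ˡ (∈-map⁺ (2 *_) h∈E)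

∈-parityUnion-odd : ∀ {h} E O → h ∈ O → suc (2 * h) ∈ parityUnion E O
∈-parityUnion-odd E O h∈O = ∈-++⁺ʳ (map (2 *_) E) (∈-map⁺ (λ h → suc (2 * h)) h∈O)

∈-parityUnion⁻ : ∀ {w} E O → w ∈ parityUnion E O →
                 (∃ λ h → h ∈ E × w ≡ 2 * h) ⊎ (∃ λ h → h ∈ O × w ≡ suc (2 * h))
∈-parityUnion⁻ E O w∈ with ∈-++⁻ (map (2 *_) E) w∈
... | inj₁ w∈E = inj₁ (∈-map⁻ (2 *_) w∈E)
... | inj₂ w∈O = inj₂ (∈-map⁻ (λ h → suc (2 * h)) w∈O)

parityUnion-unique : ∀ {E O} → Unique E → Unique O → Unique (parityUnion E O)
parityUnion-unique {E} {O} uE uO =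
  Unique.++⁺ (Unique.map⁺ (*-cancelˡ-≡ _ _ 2) uE) (Unique.map⁺ (λ eq → *-cancelˡ-≡ _ _ 2 (suc-injective eq)) uO) disjoint
  where
  disjoint : Disjoint (map (2 *_) E) (map (λ h → suc (2 * h)) O)
  disjoint (w∈E , w∈O) with h , _ , refl ← ∈-map⁻ (2 *_) w∈E
                       with h' , _ , eq ← ∈-map⁻ (λ h → suc (2 * h)) w∈O = even≢odd h h' eq

parityUnion-positive : ∀ {E O} → All (1 ≤_) E → All (1 ≤_) (parityUnion E O)
parityUnion-positive {E} {O} 1≤E = All.++⁺ (All.map⁺ (All.map (λ 1≤h → ≤-trans 1≤h (m≤m+n _ _)) 1≤E))
                                          (All.map⁺ (All.tabulate λ _ → s≤s z≤n))

length-parityUnion : ∀ E O → length (parityUnion E O) ≡ length E + length O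
length-parityUnion E O = trans (length-++ (map (2 *_) E)) (cong₂ _+_ (length-map (2 *_) E) (length-map _ O))

symmetric : List ℕ → List ℤ
symmetric P = + 0 ∷ map +_ P ++ map (λ w → ℤ.- + w) P

+≢-+ : ∀ {w w'} → 1 ≤ w' → + w ≢ ℤ.- + w'
+≢-+ (s≤s _) ()

+0≢+ : ∀ {w} → 1 ≤ w → + 0 ≢ + w
+0≢+ (s≤s _) ()

symmetric-unique : ∀ {P} → Unique P → All (1 ≤_) P → Unique (symmetric P)
symmetric-unique {P} uP 1≤P =
  All.tabulate 0∉ ∷ Unique.++⁺ (Unique.map⁺ ℤP.+-injective uP)
    (Unique.map⁺ (λ eq → ℤP.+-injective (ℤP.neg-injective eq)) uP) disjoint
  where
  0∉ : ∀ {x} → x ∈ map +_ P ++ map (λ w → ℤ.- + w) P → + 0 ≢ x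
  0∉ x∈ with ∈-++⁻ (map +_ P) x∈
  ... | inj₁ x∈+ with w , w∈ , refl ← ∈-map⁻ +_ x∈+ = +0≢+ (All.lookup 1≤P w∈)
  ... | inj₂ x∈- with w , w∈ , refl ← ∈-map⁻ (λ w → ℤ.- + w) x∈- = +≢-+ (All.lookup 1≤P w∈)
  disjoint : Disjoint (map +_ P) (map (λ w → ℤ.- + w) P)
  disjoint (x∈+ , x∈-) with w , _ , refl ← ∈-map⁻ +_ x∈+
                       with w' , w'∈ , eq ← ∈-map⁻ (λ w → ℤ.- + w) x∈- = +≢-+ (All.lookup 1≤P w'∈) eq

length-symmetric : ∀ P → length (symmetric P) ≡ suc (length P + length P)
length-symmetric P = cong suc (trans (length-++ (map +_ P)) (cong₂ _+_ (length-map +_ P) (length-map _ P)))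

[x+y]-x≡y : ∀ (x y : ℤ) → (x ℤ.+ y) ℤ.- x ≡ y
[x+y]-x≡y = ℤ-Solver.solve-∀

x-[x+y]≡-y : ∀ (x y : ℤ) → x ℤ.- (x ℤ.+ y) ≡ ℤ.- y
x-[x+y]≡-y = ℤ-Solver.solve-∀

x-x≡0 : ∀ (x : ℤ) → x ℤ.- x ≡ + 0
x-x≡0 = ℤ-Solver.solve-∀

+-minus-+ : ∀ {u v w} → u ≡ v + w → + u ℤ.- + v ≡ + w
+-minus-+ {v = v} {w} refl = [x+y]-x≡y (+ v) (+ w)

+-minus-+′ : ∀ {u v w} → v ≡ u + w → + u ℤ.- + v ≡ ℤ.- + w
+-minus-+′ {u} {w = w} refl = x-[x+y]≡-y (+ u) (+ w)

∈-symmetric-zero : ∀ P u → + u ℤ.- + u ∈ symmetric P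
∈-symmetric-zero P u = here (x-x≡0 (+ u))

∈-symmetric-pos : ∀ {P} u v {w} → w ∈ P → u ≡ v + w → + u ℤ.- + v ∈ symmetric P
∈-symmetric-pos {P} u v w∈P u≡ = there (∈-++⁺ˡ (subst (_∈ map +_ P) (sym (+-minus-+ u≡)) (∈-map⁺ +_ w∈P)))

∈-symmetric-neg : ∀ {P} u v {w} → w ∈ P → v ≡ u + w → + u ℤ.- + v ∈ symmetric P
∈-symmetric-neg {P} u v w∈P v≡ =
  there (∈-++⁺ʳ (map +_ P) (subst (_∈ map (λ w → ℤ.- + w) P) (sym (+-minus-+′ v≡)) (∈-map⁺ (λ w → ℤ.- + w) w∈P)))

-- The halves of A + A and A - A

-- Here n = 1 + p and k = 3 + q; InE and InO describe E and O (Lower and Upper being the two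
-- intervals of E), and c = 1 - b.
module Halves (p q b c p₀ : ℕ) (p≡1+p₀ : p ≡ suc p₀) (b+c≡1 : b + c ≡ 1) where

  Lower : ℕ → Set
  Lower h = ∃ λ e → h + e ≡ suc p

  Upper : ℕ → Set
  Upper h = ∃₂ λ r e → h ≡ (3 + q) * suc p + r × suc r + e ≡ suc p + b

  InE : ℕ → Set
  InE h = Lower h ⊎ Upper h

  InO : ℕ → Set
  InO h = ∃₂ λ j e → h ≡ j * suc p + p × suc j + e ≡ 3 + q

  0∈E : InE 0
  0∈E = inj₁ (suc p , refl)

  n∈E : InE (suc p)
  n∈E = inj₁ (0 , +-identityʳ (suc p))

  p∈O : InO p
  p∈O = 0 , 2 + q , refl , refl

  -- An index beyond the last full period can only hit the top element kn + n of E,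
  -- which exists exactly when b = 1.
  overshoot : ∀ r y d → r + (y * suc p + (d + c)) ≡ 0 → r ≡ 0 × y * suc p ≡ 0 × InE ((3 + q) * suc p + suc p)
  overshoot r y d sum≡0 = m+n≡0⇒m≡0 r sum≡0 , m+n≡0⇒m≡0 (y * suc p) rest≡0 ,
    inj₂ (suc p , 0 , refl , via (cong₂ _+_ (sym b+c≡1) c≡0) (solve (p ∷ b ∷ c ∷ [])))
    where
    rest≡0 : y * suc p + (d + c) ≡ 0
    rest≡0 = m+n≡0⇒n≡0 r sum≡0
    c≡0 : c ≡ 0
    c≡0 = m+n≡0⇒n≡0 d (m+n≡0⇒n≡0 (y * suc p) rest≡0)

  -- oddPairSum (j + j') = (jn + p) + (j'n + p) + 1
  oddPairSum : ℕ → ℕ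
  oddPairSum s = s * suc p + (2 * p + 1)

  ∈-oddPairSums⁺ : ∀ s c {w} t d → w ≡ (s + t) * suc p + (2 * p + 1) → suc t + d ≡ c → w ∈ map oddPairSum (interval s c)
  ∈-oddPairSums⁺ s c t d refl t<c = ∈-map⁺ oddPairSum (∈-interval⁺ s c t d refl t<c)

  ∈-oddPairSums⁻ : ∀ s c {w} → w ∈ map oddPairSum (interval s c) →
                     ∃₂ λ t d → w ≡ (s + t) * suc p + (2 * p + 1) × suc t + d ≡ c
  ∈-oddPairSums⁻ s c w∈ with v , v∈ , refl ← ∈-map⁻ oddPairSum w∈
                    with t , d , refl , t<c ← ∈-interval⁻ s c v∈ = t , d , refl , t<c

  oddPairSums-UniqueAbove : ∀ s c → UniqueAbove (s * suc p + (2 * p + 1)) (map oddPairSum (interval s c))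
  oddPairSums-UniqueAbove s c =
    Unique.map⁺ (λ {x} {y} eq → *-cancelʳ-≡ x y (suc p) (+-cancelʳ-≡ (2 * p + 1) _ _ eq)) (interval-unique s c) ,
    All.tabulate lower
    where
    lower : ∀ {w} → w ∈ map oddPairSum (interval s c) → s * suc p + (2 * p + 1) ≤ w
    lower w∈ with t , _ , refl , _ ← ∈-oddPairSums⁻ s c w∈ =
      ≤-by {s * suc p + (2 * p + 1)} {(s + t) * suc p + (2 * p + 1)} (t * suc p) (solve (p ∷ s ∷ t ∷ []))

  oddPairSums-< : ∀ s c → All (_< suc (s + c) * suc p) (map oddPairSum (interval s c))
  oddPairSums-< s c = All.tabulate upper
    where
    upper : ∀ {w} → w ∈ map oddPairSum (interval s c) → w < suc (s + c) * suc p
    upper w∈ with t , d , refl , t<c ← ∈-oddPairSums⁻ s c w∈ =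
      <-by {(s + t) * suc p + (2 * p + 1)} {suc (s + c) * suc p} (d * suc p)
        (via (cong (_* suc p) t<c) (solve (p ∷ s ∷ c ∷ t ∷ d ∷ [])))

  ∈-multiples⁺ : ∀ s c {w} t d → w ≡ (s + t) * suc p → suc t + d ≡ c → w ∈ map (_* suc p) (interval s c)
  ∈-multiples⁺ s c t d refl t<c = ∈-map⁺ (_* suc p) (∈-interval⁺ s c t d refl t<c)

  ∈-multiples⁻ : ∀ s c {w} → w ∈ map (_* suc p) (interval s c) → ∃₂ λ t d → w ≡ (s + t) * suc p × suc t + d ≡ c
  ∈-multiples⁻ s c w∈ with v , v∈ , refl ← ∈-map⁻ (_* suc p) w∈
                      with t , d , refl , t<c ← ∈-interval⁻ s c v∈ = t , d , refl , t<c

  multiples-UniqueAbove : ∀ s c → UniqueAbove (s * suc p) (map (_* suc p) (interval s c))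
  multiples-UniqueAbove s c =
    Unique.map⁺ (λ {x} {y} eq → *-cancelʳ-≡ x y (suc p) eq) (interval-unique s c) ,
    All.tabulate lower
    where
    lower : ∀ {w} → w ∈ map (_* suc p) (interval s c) → s * suc p ≤ w
    lower w∈ with t , _ , refl , _ ← ∈-multiples⁻ s c w∈ =
      ≤-by {s * suc p} {(s + t) * suc p} (t * suc p) (solve (p ∷ s ∷ t ∷ []))

  multiples-< : ∀ s c → All (_< (s + c) * suc p) (map (_* suc p) (interval s c))
  multiples-< s c = All.tabulate upper
    where
    upper : ∀ {w} → w ∈ map (_* suc p) (interval s c) → w < (s + c) * suc p
    upper w∈ with t , d , refl , t<c ← ∈-multiples⁻ s c w∈ =
      <-by {(s + t) * suc p} {(s + c) * suc p} (p + d * suc p) (via (cong (_* suc p) t<c) (solve (p ∷ s ∷ c ∷ t ∷ d ∷ [])))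

  -- E + E and O + O + 1 are covered in increasing order by [0, 2n], the oddPairSums below kn,
  -- [kn, kn + 2n - 1 + b], the oddPairSums above it and [2kn, 2kn + 2n - 2 + 2b]; E + O is an interval.
  S₁ S₂ S₃ S₄ S₅ : List ℕ
  S₁ = interval 0 (3 + 2 * p)
  S₂ = map oddPairSum (interval 1 (suc q))
  S₃ = interval ((3 + q) * suc p) (2 + 2 * p + b)
  S₄ = map oddPairSum (interval (4 + q) (suc q))
  S₅ = interval (2 * ((3 + q) * suc p)) (1 + 2 * p + 2 * b)

  evenSums : List ℕ
  evenSums = S₁ ++ S₂ ++ S₃ ++ S₄ ++ S₅

  oddSums : List ℕ
  oddSums = interval p (2 * ((3 + q) * suc p) + b)

  S₁⊆ : S₁ ⊆ evenSums
  S₁⊆ = ∈-++⁺ˡ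
  S₂⊆ : S₂ ⊆ evenSums
  S₂⊆ w∈ = ∈-++⁺ʳ S₁ (∈-++⁺ˡ w∈)
  S₃⊆ : S₃ ⊆ evenSums
  S₃⊆ w∈ = ∈-++⁺ʳ S₁ (∈-++⁺ʳ S₂ (∈-++⁺ˡ w∈))
  S₄⊆ : S₄ ⊆ evenSums
  S₄⊆ w∈ = ∈-++⁺ʳ S₁ (∈-++⁺ʳ S₂ (∈-++⁺ʳ S₃ (∈-++⁺ˡ w∈)))
  S₅⊆ : S₅ ⊆ evenSums
  S₅⊆ w∈ = ∈-++⁺ʳ S₁ (∈-++⁺ʳ S₂ (∈-++⁺ʳ S₃ (∈-++⁺ʳ S₄ w∈)))

  Lower+Upper∈evenSums : ∀ {h h'} → Lower h → Upper h' → h + h' ∈ evenSums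
  Lower+Upper∈evenSums {h} (e , h≤n) (r , e' , refl , r<n+b) =
    S₃⊆ (∈-interval⁺ ((3 + q) * suc p) (2 + 2 * p + b) {h + ((3 + q) * suc p + r)} (h + r) (e + e') (solve (p ∷ q ∷ h ∷ r ∷ []))
      (via (cong₂ _+_ h≤n r<n+b) (solve (p ∷ q ∷ b ∷ h ∷ r ∷ e ∷ e' ∷ []))))

  InE+InE∈evenSums : ∀ {h h'} → InE h → InE h' → h + h' ∈ evenSums
  InE+InE∈evenSums {h} {h'} (inj₁ (e , h≤n)) (inj₁ (e' , h'≤n)) =
    S₁⊆ (∈-interval⁺ 0 (3 + 2 * p) (h + h') (e + e') refl (via (cong₂ _+_ h≤n h'≤n) (solve (p ∷ h ∷ h' ∷ e ∷ e' ∷ []))))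
  InE+InE∈evenSums         (inj₁ low) (inj₂ up) = Lower+Upper∈evenSums low up
  InE+InE∈evenSums {h} {h'} (inj₂ up) (inj₁ low) = subst (_∈ evenSums) (+-comm h' h) (Lower+Upper∈evenSums low up)
  InE+InE∈evenSums (inj₂ (r , e , refl , r<n+b)) (inj₂ (r' , e' , refl , r'<n+b)) =
    S₅⊆ (∈-interval⁺ (2 * ((3 + q) * suc p)) (1 + 2 * p + 2 * b) {(3 + q) * suc p + r + ((3 + q) * suc p + r')}
        (r + r') (e + e') (solve (p ∷ q ∷ r ∷ r' ∷ []))
      (via (cong₂ _+_ r<n+b r'<n+b) (solve (p ∷ q ∷ b ∷ r ∷ r' ∷ e ∷ e' ∷ []))))

  oddPairSum∈evenSums : ∀ s x → s + x ≡ 4 + 2 * q → oddPairSum s ∈ evenSums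
  oddPairSum∈evenSums zero _ _ = S₁⊆ (∈-interval⁺ 0 (3 + 2 * p) {oddPairSum 0} (2 * p + 1) 1 refl (solve (p ∷ [])))
  oddPairSum∈evenSums (suc u) x s+x≡4+2q with ≤⊎> u q
  ... | inj₁ (d , u+d≡q) = S₂⊆ (∈-oddPairSums⁺ 1 (suc q) u d refl (cong suc u+d≡q))
  ... | inj₂ (0 , refl) =
    S₃⊆ (∈-interval⁺ ((3 + q) * suc p) (2 + 2 * p + b) {suc (q + 1) * suc p + (2 * p + 1)} p (suc p + b)
      (solve (p ∷ q ∷ [])) (solve (p ∷ b ∷ [])))
  ... | inj₂ (1 , refl) =
    S₃⊆ (∈-interval⁺ ((3 + q) * suc p) (2 + 2 * p + b) {suc (q + 2) * suc p + (2 * p + 1)} (2 * p + 1) b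
      (solve (p ∷ q ∷ [])) (solve (p ∷ b ∷ [])))
  ... | inj₂ (suc (suc v) , refl) =
    S₄⊆ (∈-oddPairSums⁺ (4 + q) (suc q) {suc (q + suc (suc (suc v))) * suc p + (2 * p + 1)} v x
      (solve (p ∷ q ∷ v ∷ [])) (via s+x≡4+2q (solve (q ∷ v ∷ x ∷ []))))

  InO+InO∈evenSums : ∀ {h h'} → InO h → InO h' → suc (h + h') ∈ evenSums
  InO+InO∈evenSums (j , e , refl , j<k) (j' , e' , refl , j'<k) =
    subst (_∈ evenSums) oddPairSum≡
      (oddPairSum∈evenSums (j + j') (e + e') (via (cong₂ _+_ j<k j'<k) (solve (q ∷ j ∷ j' ∷ e ∷ e' ∷ []))))
    where
    oddPairSum≡ : (j + j') * suc p + (2 * p + 1) ≡ suc (j * suc p + p + (j' * suc p + p))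
    oddPairSum≡ = solve (p ∷ j ∷ j' ∷ [])

  InE+InO∈oddSums : ∀ {h h'} → InE h → InO h' → h + h' ∈ oddSums
  InE+InO∈oddSums {h} (inj₁ (e₁ , h≤n)) (j , e , refl , j<k) =
    ∈-interval⁺ p (2 * ((3 + q) * suc p) + b) {h + (j * suc p + p)} (h + j * suc p)
      ((2 + q) * suc p + p + b + e₁ + e * suc p) (solve (p ∷ h ∷ j ∷ []))
      (via (cong₂ _+_ h≤n (cong (_* suc p) j<k)) (solve (p ∷ q ∷ b ∷ h ∷ j ∷ e ∷ e₁ ∷ [])))
  InE+InO∈oddSums (inj₂ (r , e₁ , refl , r<n+b)) (j , e , refl , j<k) =
    ∈-interval⁺ p (2 * ((3 + q) * suc p) + b) {(3 + q) * suc p + r + (j * suc p + p)} ((3 + q) * suc p + r + j * suc p)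
      (e₁ + e * suc p) (solve (p ∷ q ∷ r ∷ j ∷ []))
      (via (cong₂ _+_ r<n+b (cong (_* suc p) j<k)) (solve (p ∷ q ∷ b ∷ r ∷ j ∷ e ∷ e₁ ∷ [])))

  EvenSum : ℕ → Set
  EvenSum w = (∃₂ λ h h' → InE h × InE h' × w ≡ h + h') ⊎ (∃₂ λ h h' → InO h × InO h' × w ≡ suc (h + h'))

  OddSum : ℕ → Set
  OddSum w = ∃₂ λ h h' → InE h × InO h' × w ≡ h + h'

  S₁-split : ∀ {w} → w ∈ S₁ → EvenSum w
  S₁-split w∈ with t , d , refl , t<c ← ∈-interval⁻ 0 (3 + 2 * p) w∈ with ≤⊎> t (suc p)
  ... | inj₁ t≤n = inj₁ (t , 0 , inj₁ t≤n , 0∈E , sym (+-identityʳ t))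
  ... | inj₂ (x , refl) = inj₁ (suc p , suc x , n∈E , inj₁ (d , via t<c (solve (p ∷ x ∷ d ∷ []))) , refl)

  S₂-split : ∀ {w} → w ∈ S₂ → EvenSum w
  S₂-split w∈ with t , d , refl , t<c ← ∈-oddPairSums⁻ 1 (suc q) w∈ =
    inj₂ (suc t * suc p + p , p , (suc t , suc d , refl , via t<c (solve (q ∷ t ∷ d ∷ []))) , p∈O ,
          solve (p ∷ t ∷ []))

  S₃-split : ∀ {w} → w ∈ S₃ → EvenSum w
  S₃-split w∈ with t , d , refl , t<c ← ∈-interval⁻ ((3 + q) * suc p) (2 + 2 * p + b) w∈ with ≤⊎> t p
  ... | inj₁ (x , t+x≡p) =
    inj₁ ((3 + q) * suc p + t , 0 , inj₂ (t , x + b , refl , via t+x≡p (solve (p ∷ b ∷ t ∷ x ∷ []))) , 0∈E ,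
          solve (p ∷ q ∷ t ∷ []))
  ... | inj₂ (x , refl) =
    inj₁ ((3 + q) * suc p + x , suc p , inj₂ (x , d , refl , via t<c (solve (p ∷ b ∷ x ∷ d ∷ []))) , n∈E ,
          solve (p ∷ q ∷ x ∷ []))

  S₄-split : ∀ {w} → w ∈ S₄ → EvenSum w
  S₄-split w∈ with t , d , refl , t<c ← ∈-oddPairSums⁻ (4 + q) (suc q) w∈ =
    inj₂ ((2 + q) * suc p + p , (2 + t) * suc p + p , (2 + q , 0 , refl , solve (q ∷ [])) ,
          (2 + t , d , refl , via t<c (solve (q ∷ t ∷ d ∷ []))) , solve (p ∷ q ∷ t ∷ []))

  S₅-split : ∀ {w} → w ∈ S₅ → EvenSum w
  S₅-split w∈ with t , d , refl , t<c ← ∈-interval⁻ (2 * ((3 + q) * suc p)) (1 + 2 * p + 2 * b) w∈ with ≤⊎> t (p + b)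
  ... | inj₁ (x , t+x≡p+b) =
    inj₁ ((3 + q) * suc p + t , (3 + q) * suc p + 0 , inj₂ (t , x , refl , via t+x≡p+b (solve (p ∷ b ∷ t ∷ x ∷ []))) ,
          inj₂ (0 , p + b , refl , refl) , solve (p ∷ q ∷ t ∷ []))
  ... | inj₂ (x , refl) =
    inj₁ ((3 + q) * suc p + (p + b) , (3 + q) * suc p + suc x , inj₂ (p + b , 0 , refl , solve (p ∷ b ∷ [])) ,
          inj₂ (suc x , d , refl , via t<c (solve (p ∷ b ∷ x ∷ d ∷ []))) , solve (p ∷ q ∷ b ∷ x ∷ []))

  evenSums-split : ∀ {w} → w ∈ evenSums → EvenSum w
  evenSums-split w∈ with ∈-++⁻ S₁ w∈
  ... | inj₁ w∈S₁ = S₁-split w∈S₁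
  ... | inj₂ w∈ with ∈-++⁻ S₂ w∈
  ...   | inj₁ w∈S₂ = S₂-split w∈S₂
  ...   | inj₂ w∈ with ∈-++⁻ S₃ w∈
  ...     | inj₁ w∈S₃ = S₃-split w∈S₃
  ...     | inj₂ w∈ with ∈-++⁻ S₄ w∈
  ...       | inj₁ w∈S₄ = S₄-split w∈S₄
  ...       | inj₂ w∈S₅ = S₅-split w∈S₅

  -- With t = r + jn and r < n, the summand from O is jn + p when j < k, and otherwise the summand
  -- from E has to come from its upper interval.
  OddSum-by-division : ∀ t d r j e → suc t + d ≡ 2 * ((3 + q) * suc p) + b → t ≡ r + j * suc p → suc r + e ≡ suc p →
                       OddSum (p + t)
  OddSum-by-division _ d r j e t<c refl r<n with ≤⊎> j (2 + q)
  ... | inj₁ (x , j+x≡2+q) =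
    r , j * suc p + p , inj₁ (suc e , via r<n (solve (p ∷ r ∷ e ∷ []))) ,
    (j , x , refl , via j+x≡2+q (solve (q ∷ j ∷ x ∷ []))) , solve (p ∷ r ∷ j ∷ [])
  ... | inj₂ (x , refl) with ≤⊎> (suc x) (3 + q)
  ...   | inj₁ (y , x<k) =
    (3 + q) * suc p + r , x * suc p + p , inj₂ (r , e + b , refl , via r<n (solve (p ∷ b ∷ r ∷ e ∷ []))) ,
    (x , y , refl , x<k) , solve (p ∷ q ∷ r ∷ x ∷ [])
  ...   | inj₂ (y , refl) with r≡0 , yn≡0 , top∈E ← overshoot r y d
      (via (cong₂ _+_ t<c b+c≡1) (solve (p ∷ q ∷ b ∷ c ∷ r ∷ y ∷ d ∷ []))) =
    (3 + q) * suc p + suc p , (2 + q) * suc p + p , top∈E , (2 + q , 0 , refl , solve (q ∷ [])) ,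
    via (cong₂ _+_ r≡0 yn≡0) (solve (p ∷ q ∷ r ∷ y ∷ []))

  oddSums-split : ∀ {w} → w ∈ oddSums → OddSum w
  oddSums-split w∈ with t , d , refl , t<c ← ∈-interval⁻ p (2 * ((3 + q) * suc p) + b) w∈
                   with e , r<n ← m≤n⇒∃[o]m+o≡n (m%n<n t (suc p)) =
    OddSum-by-division t d (t % suc p) (t / suc p) e t<c (m≡m%n+[m/n]*n t (suc p)) r<n

  -- P is covered by [1, n], {jn : 2 ≤ j < k - 1} and [(k - 1)n, (k + 1)n - 1 + b]; Q is an interval.
  D₁ D₂ D₃ : List ℕ
  D₁ = interval 1 (suc p)
  D₂ = map (_* suc p) (interval 2 q)
  D₃ = interval ((2 + q) * suc p) (2 * suc p + b)

  evenDiffs : List ℕ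
  evenDiffs = D₁ ++ D₂ ++ D₃

  oddDiffs : List ℕ
  oddDiffs = interval 0 ((3 + q) * suc p + b)

  D₁⊆ : D₁ ⊆ evenDiffs
  D₁⊆ = ∈-++⁺ˡ
  D₂⊆ : D₂ ⊆ evenDiffs
  D₂⊆ w∈ = ∈-++⁺ʳ D₁ (∈-++⁺ˡ w∈)
  D₃⊆ : D₃ ⊆ evenDiffs
  D₃⊆ w∈ = ∈-++⁺ʳ D₁ (∈-++⁺ʳ D₂ w∈)

  InE-InE∈evenDiffs : ∀ {h h'} d → InE h → InE h' → h ≡ suc (h' + d) → suc d ∈ evenDiffs
  InE-InE∈evenDiffs {h' = h'} d (inj₁ (e , h≤n)) (inj₁ _) refl =
    D₁⊆ (∈-interval⁺ 1 (suc p) {suc d} d (h' + e) refl (via h≤n (solve (p ∷ h' ∷ d ∷ e ∷ []))))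
  InE-InE∈evenDiffs d (inj₁ (e , h≤n)) (inj₂ (r' , _ , refl , _)) refl =
    ⊥-elim (1+n≢0 {(2 + q) * suc p + r' + d + e} (via h≤n (solve (p ∷ q ∷ r' ∷ d ∷ e ∷ []))))
  InE-InE∈evenDiffs {h' = h'} d (inj₂ (r , e , refl , r<n+b)) (inj₁ (e' , h'≤n)) h≡ =
    D₃⊆ (∈-interval⁺ ((2 + q) * suc p) (2 * suc p + b) {suc d} (e' + r) (e + h')
      (via (cong₂ _+_ (sym h≡) (sym h'≤n)) (solve (p ∷ q ∷ r ∷ e' ∷ h' ∷ d ∷ [])))
      (via (cong₂ _+_ r<n+b h'≤n) (solve (p ∷ b ∷ r ∷ e ∷ e' ∷ h' ∷ []))))
  InE-InE∈evenDiffs d (inj₂ (r , e , refl , r<n+b)) (inj₂ (r' , _ , refl , _)) h≡ =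
    D₁⊆ (∈-interval⁺ 1 (suc p) {suc d} d (r' + e + c) refl
      (via (cong₂ _+_ (cong₂ _+_ r<n+b b+c≡1) (sym h≡)) (solve (p ∷ q ∷ b ∷ c ∷ r ∷ r' ∷ e ∷ d ∷ []))))

  InO-InO∈evenDiffs : ∀ {h h'} d → InO h → InO h' → h ≡ suc (h' + d) → suc d ∈ evenDiffs
  InO-InO∈evenDiffs d (j , e , refl , j<k) (j' , _ , refl , _) h≡ with ≤⊎> j j'
  ... | inj₁ (x , refl) = ⊥-elim (1+n≢0 {d + x * suc p} (via (sym h≡) (solve (p ∷ j ∷ x ∷ d ∷ []))))
  ... | inj₂ (zero , refl) =
    D₁⊆ (∈-interval⁺ 1 (suc p) {suc d} p 0 (via (sym h≡) (solve (p ∷ j' ∷ d ∷ []))) (solve (p ∷ [])))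
  ... | inj₂ (suc x , refl) with ≤⊎> x q
  ...   | inj₁ (zero , x≡q) =
    D₃⊆ (∈-interval⁺ ((2 + q) * suc p) (2 * suc p + b) {suc d} 0 (2 * p + 1 + b)
      (via (cong₂ _+_ (sym h≡) (cong (_* suc p) x≡q)) (solve (p ∷ q ∷ j' ∷ x ∷ d ∷ []))) (solve (p ∷ b ∷ [])))
  ...   | inj₁ (suc y , x<q) =
    D₂⊆ (∈-multiples⁺ 2 q {suc d} x y (via (sym h≡) (solve (p ∷ j' ∷ x ∷ d ∷ []))) (via x<q (solve (q ∷ x ∷ y ∷ []))))
  ...   | inj₂ (y , refl) = ⊥-elim (1+n≢0 {j' + y + e} (via j<k (solve (q ∷ j' ∷ y ∷ e ∷ []))))

  InE-InO∈oddDiffs : ∀ {h h'} d → InE h → InO h' → h ≡ suc (h' + d) → d ∈ oddDiffs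
  InE-InO∈oddDiffs d (inj₁ (e₁ , h≤n)) (j , _ , refl , _) refl =
    ∈-interval⁺ 0 ((3 + q) * suc p + b) {d} d ((2 + q) * suc p + p + b + e₁ + j * suc p) refl
      (via h≤n (solve (p ∷ q ∷ b ∷ j ∷ d ∷ e₁ ∷ [])))
  InE-InO∈oddDiffs d (inj₂ (r , e₁ , refl , r<n+b)) (j , _ , refl , _) h≡ =
    ∈-interval⁺ 0 ((3 + q) * suc p + b) {d} d (e₁ + j * suc p) refl
      (via (cong₂ _+_ (sym h≡) r<n+b) (solve (p ∷ q ∷ b ∷ j ∷ d ∷ e₁ ∷ r ∷ [])))

  InO-minus∈oddDiffs : ∀ {h} h' d → InO h → h ≡ h' + d → d ∈ oddDiffs
  InO-minus∈oddDiffs h' d (j , e , refl , j<k) h≡ =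
    ∈-interval⁺ 0 ((3 + q) * suc p + b) {d} d (e * suc p + b + h') refl
      (via (cong₂ _+_ (sym h≡) (cong (_* suc p) j<k)) (solve (p ∷ q ∷ b ∷ j ∷ e ∷ d ∷ h' ∷ [])))

  EvenDiff : ℕ → Set
  EvenDiff w = (∃₂ λ h h' → InE h × InE h' × h ≡ h' + w) ⊎ (∃₂ λ h h' → InO h × InO h' × h ≡ h' + w)

  OddDiff : ℕ → Set
  OddDiff d = ∃₂ λ h h' → InE h × InO h' × h ≡ h' + suc d

  D₁-split : ∀ {w} → w ∈ D₁ → EvenDiff w
  D₁-split w∈ with t , d , refl , t<n ← ∈-interval⁻ 1 (suc p) w∈ = inj₁ (suc t , 0 , inj₁ (d , t<n) , 0∈E , refl)

  D₂-split : ∀ {w} → w ∈ D₂ → EvenDiff w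
  D₂-split w∈ with t , d , refl , t<q ← ∈-multiples⁻ 2 q w∈ =
    inj₂ ((2 + t) * suc p + p , p , (2 + t , suc d , refl , via t<q (solve (q ∷ t ∷ d ∷ []))) , p∈O , +-comm _ p)

  D₃-split : ∀ {w} → w ∈ D₃ → EvenDiff w
  D₃-split w∈ with t , d , refl , t<c ← ∈-interval⁻ ((2 + q) * suc p) (2 * suc p + b) w∈ with ≤⊎> t p
  ... | inj₁ (y , t+y≡p) =
    inj₁ ((3 + q) * suc p + 0 , suc y , inj₂ (0 , p + b , refl , refl) , inj₁ (t , via t+y≡p (solve (p ∷ t ∷ y ∷ []))) ,
          via (sym t+y≡p) (solve (p ∷ q ∷ t ∷ y ∷ [])))
  ... | inj₂ (y , refl) =
    inj₁ ((3 + q) * suc p + y , 0 , inj₂ (y , d , refl , via t<c (solve (p ∷ b ∷ y ∷ d ∷ []))) , 0∈E ,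
          solve (p ∷ q ∷ y ∷ []))

  evenDiffs-split : ∀ {w} → w ∈ evenDiffs → EvenDiff w
  evenDiffs-split w∈ with ∈-++⁻ D₁ w∈
  ... | inj₁ w∈D₁ = D₁-split w∈D₁
  ... | inj₂ w∈ with ∈-++⁻ D₂ w∈
  ...   | inj₁ w∈D₂ = D₂-split w∈D₂
  ...   | inj₂ w∈D₃ = D₃-split w∈D₃

  OddDiff-by-division : ∀ t d r j e → suc t + d ≡ (3 + q) * suc p + b → t ≡ r + j * suc p → suc r + e ≡ suc p →
                        OddDiff t
  OddDiff-by-division _ d r j e t<c refl r<n with ≤⊎> j (2 + q)
  ... | inj₁ (y , j+y≡2+q) =
    (3 + q) * suc p + r , y * suc p + p , inj₂ (r , e + b , refl , via r<n (solve (p ∷ b ∷ r ∷ e ∷ []))) ,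
    (y , j , refl , via j+y≡2+q (solve (q ∷ y ∷ j ∷ []))) ,
    via (sym (cong (_* suc p) j+y≡2+q)) (solve (p ∷ q ∷ r ∷ j ∷ y ∷ []))
  ... | inj₂ (y , refl) with r≡0 , yn≡0 , top∈E ← overshoot r y d
      (via (cong₂ _+_ t<c b+c≡1) (solve (p ∷ q ∷ b ∷ c ∷ r ∷ y ∷ d ∷ []))) =
    (3 + q) * suc p + suc p , p , top∈E , p∈O , via (sym (cong₂ _+_ r≡0 yn≡0)) (solve (p ∷ q ∷ r ∷ y ∷ []))

  oddDiffs-split : ∀ {d} → d ∈ oddDiffs → OddDiff d
  oddDiffs-split d∈ with t , d , refl , t<c ← ∈-interval⁻ 0 ((3 + q) * suc p + b) d∈
                    with e , r<n ← m≤n⇒∃[o]m+o≡n (m%n<n t (suc p)) =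
    OddDiff-by-division t d (t % suc p) (t / suc p) e t<c (m≡m%n+[m/n]*n t (suc p)) r<n

  evenSums-UniqueAbove : UniqueAbove 0 evenSums
  evenSums-UniqueAbove =
    UniqueAbove-++ z≤n (interval-UniqueAbove 0 (3 + 2 * p))
      (All<-weaken (≤-by {3 + 2 * p} {1 * suc p + (2 * p + 1)} p₀ (via (sym p≡1+p₀) (solve (p ∷ p₀ ∷ []))))
        (interval-< 0 (3 + 2 * p)))
    (UniqueAbove-++ (≤-by {1 * suc p + (2 * p + 1)} {(3 + q) * suc p} (1 + q * suc p) (solve (p ∷ q ∷ [])))
      (oddPairSums-UniqueAbove 1 (suc q)) (oddPairSums-< 1 (suc q))
    (UniqueAbove-++ (≤-by {(3 + q) * suc p} {(4 + q) * suc p + (2 * p + 1)} (3 * p + 2) (solve (p ∷ q ∷ [])))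
      (interval-UniqueAbove ((3 + q) * suc p) (2 + 2 * p + b))
      (All<-weaken (≤-by {(3 + q) * suc p + (2 + 2 * p + b)} {(4 + q) * suc p + (2 * p + 1)} (p₀ + c)
                     (via (cong₂ _+_ b+c≡1 (sym p≡1+p₀)) (solve (p ∷ q ∷ b ∷ c ∷ p₀ ∷ []))))
        (interval-< ((3 + q) * suc p) (2 + 2 * p + b)))
    (UniqueAbove-++ (≤-by {(4 + q) * suc p + (2 * p + 1)} {2 * ((3 + q) * suc p)} (1 + q * suc p) (solve (p ∷ q ∷ [])))
      (oddPairSums-UniqueAbove (4 + q) (suc q))
      (All<-weaken (≤-by {suc (4 + q + suc q) * suc p} {2 * ((3 + q) * suc p)} 0 (solve (p ∷ q ∷ [])))
        (oddPairSums-< (4 + q) (suc q)))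
    (interval-UniqueAbove (2 * ((3 + q) * suc p)) (1 + 2 * p + 2 * b)))))

  evenDiffs-UniqueAbove : UniqueAbove 1 evenDiffs
  evenDiffs-UniqueAbove =
    UniqueAbove-++ (≤-by {1} {2 * suc p} (2 * p + 1) (solve (p ∷ []))) (interval-UniqueAbove 1 (suc p))
      (All<-weaken (≤-by {1 + suc p} {2 * suc p} p (solve (p ∷ []))) (interval-< 1 (suc p)))
    (UniqueAbove-++ (≤-by {2 * suc p} {(2 + q) * suc p} (q * suc p) (solve (p ∷ q ∷ [])))
      (multiples-UniqueAbove 2 q) (multiples-< 2 q)
    (interval-UniqueAbove ((2 + q) * suc p) (2 * suc p + b)))

  length-evenSums : length evenSums ≡ (3 + 2 * p) + (suc q + ((2 + 2 * p + b) + (suc q + (1 + 2 * p + 2 * b))))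
  length-evenSums =
    length-++-≡ S₁ (length-interval 0 (3 + 2 * p)) (length-++-≡ S₂ (length-map-interval oddPairSum 1 (suc q))
      (length-++-≡ S₃ (length-interval ((3 + q) * suc p) (2 + 2 * p + b))
      (length-++-≡ S₄ (length-map-interval oddPairSum (4 + q) (suc q)) (length-interval (2 * ((3 + q) * suc p)) (1 + 2 * p + 2 * b)))))

  length-evenDiffs : length evenDiffs ≡ suc p + (q + (2 * suc p + b))
  length-evenDiffs =
    length-++-≡ D₁ (length-interval 1 (suc p))
      (length-++-≡ D₂ (length-map-interval (_* suc p) 2 q) (length-interval ((2 + q) * suc p) (2 * suc p + b)))

  sums : List ℤ
  sums = map +_ (parityUnion evenSums oddSums)

  posDiffs : List ℕ
  posDiffs = parityUnion evenDiffs oddDiffs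

  diffs : List ℤ
  diffs = symmetric posDiffs

  sums-unique : Unique sums
  sums-unique = Unique.map⁺ ℤP.+-injective (parityUnion-unique (proj₁ evenSums-UniqueAbove) (interval-unique _ _))

  diffs-unique : Unique diffs
  diffs-unique = symmetric-unique (parityUnion-unique (proj₁ evenDiffs-UniqueAbove) (interval-unique _ _))
                   (parityUnion-positive {O = oddDiffs} (proj₂ evenDiffs-UniqueAbove))

  length-sums≡length-diffs+1 : length sums ≡ length diffs + 1
  length-sums≡length-diffs+1 = begin
    length sums                                  ≡⟨ length-map +_ (parityUnion evenSums oddSums) ⟩
    length (parityUnion evenSums oddSums)        ≡⟨ length-parityUnion evenSums oddSums ⟩
    length evenSums + length oddSums             ≡⟨ cong₂ _+_ length-evenSums (length-interval _ _) ⟩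
    (3 + 2 * p) + (suc q + ((2 + 2 * p + b) + (suc q + (1 + 2 * p + 2 * b)))) + (2 * ((3 + q) * suc p) + b)
      ≡⟨ solve (p ∷ q ∷ b ∷ []) ⟩
    suc (((suc p + (q + (2 * suc p + b))) + ((3 + q) * suc p + b)) + ((suc p + (q + (2 * suc p + b))) + ((3 + q) * suc p + b))) + 1
      ≡⟨ cong (λ l → suc (l + l) + 1) (sym length-diffHalves) ⟩
    suc (length posDiffs + length posDiffs) + 1  ≡⟨ cong (_+ 1) (sym (length-symmetric posDiffs)) ⟩
    length diffs + 1                             ∎
    where
    open ≡-Reasoning
    length-diffHalves : length posDiffs ≡ (suc p + (q + (2 * suc p + b))) + ((3 + q) * suc p + b)
    length-diffHalves = trans (length-parityUnion evenDiffs oddDiffs) (cong₂ _+_ length-evenDiffs (length-interval _ _))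

  InA : ℤ → Set
  InA x = (∃ λ h → InE h × x ≡ + (2 * h)) ⊎ (∃ λ h → InO h × x ≡ + suc (2 * h))

  record Realises (A : List ℤ) : Set where
    field
      ∈-split : ∀ {x} → x ∈ A → InA x
      even∈   : ∀ {h} → InE h → + (2 * h) ∈ A
      odd∈    : ∀ {h} → InO h → + suc (2 * h) ∈ A

  module _ {A : List ℤ} (realises : Realises A) where
    open Realises realises

    ∈-sums : ∀ {x} w → w ∈ parityUnion evenSums oddSums → x ≡ w → + x ∈ sums
    ∈-sums w w∈ refl = ∈-map⁺ +_ w∈

    ⊕⊆sums : A ⊕ A ⊆ sums
    ⊕⊆sums x∈ with u , v , u∈ , v∈ , refl ← ∈-cartesianProductWith⁻ ℤ._+_ A A x∈ with ∈-split u∈ | ∈-split v∈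
    ... | inj₁ (h , hE , refl) | inj₁ (h' , h'E , refl) =
      ∈-sums _ (∈-parityUnion-even evenSums oddSums (InE+InE∈evenSums hE h'E)) (even+even h h')
    ... | inj₁ (h , hE , refl) | inj₂ (h' , h'O , refl) =
      ∈-sums _ (∈-parityUnion-odd evenSums oddSums (InE+InO∈oddSums hE h'O)) (even+odd h h')
    ... | inj₂ (h , hO , refl) | inj₁ (h' , h'E , refl) =
      ∈-sums _ (∈-parityUnion-odd evenSums oddSums (InE+InO∈oddSums h'E hO)) (odd+even h h')
    ... | inj₂ (h , hO , refl) | inj₂ (h' , h'O , refl) =
      ∈-sums _ (∈-parityUnion-even evenSums oddSums (InO+InO∈evenSums hO h'O)) (odd+odd h h')

    ∈-⊕ : ∀ {u v w} → + u ∈ A → + v ∈ A → u + v ≡ w → + w ∈ A ⊕ A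
    ∈-⊕ u∈ v∈ refl = ∈-cartesianProductWith⁺ ℤ._+_ u∈ v∈

    sums⊆⊕ : sums ⊆ A ⊕ A
    sums⊆⊕ x∈ with w , w∈ , refl ← ∈-map⁻ +_ x∈ = parityUnion⊆⊕ w∈
      where
      parityUnion⊆⊕ : ∀ {w} → w ∈ parityUnion evenSums oddSums → + w ∈ A ⊕ A
      parityUnion⊆⊕ w∈ with ∈-parityUnion⁻ evenSums oddSums w∈
      ... | inj₁ (e , e∈ , refl) with evenSums-split e∈
      ...   | inj₁ (h , h' , hE , h'E , refl) = ∈-⊕ (even∈ hE) (even∈ h'E) (even+even h h')
      ...   | inj₂ (h , h' , hO , h'O , refl) = ∈-⊕ (odd∈ hO) (odd∈ h'O) (odd+odd h h')
      parityUnion⊆⊕ w∈ | inj₂ (o , o∈ , refl) with h , h' , hE , h'O , refl ← oddSums-split o∈ =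
        ∈-⊕ (even∈ hE) (odd∈ h'O) (even+odd h h')

    ⊖⊆diffs : A ⊖ A ⊆ diffs
    ⊖⊆diffs x∈ with u , v , u∈ , v∈ , refl ← ∈-cartesianProductWith⁻ ℤ._-_ A A x∈
      = difference (∈-split u∈) (∈-split v∈)
      where
      even-diff : ∀ {e} → e ∈ evenDiffs → 2 * e ∈ posDiffs
      even-diff = ∈-parityUnion-even evenDiffs oddDiffs
      odd-diff : ∀ {o} → o ∈ oddDiffs → suc (2 * o) ∈ posDiffs
      odd-diff = ∈-parityUnion-odd evenDiffs oddDiffs

      difference : ∀ {u v} → InA u → InA v → u ℤ.- v ∈ diffs
      difference (inj₁ (h , hE , refl)) (inj₁ (h' , h'E , refl)) with compare h h'
      ... | less _ d    = ∈-symmetric-neg (2 * h) (2 * h')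
        (even-diff (InE-InE∈evenDiffs d h'E hE refl)) (solve (h ∷ d ∷ []))
      ... | equal _     = ∈-symmetric-zero posDiffs (2 * h)
      ... | greater _ d = ∈-symmetric-pos (2 * h) (2 * h')
        (even-diff (InE-InE∈evenDiffs d hE h'E refl)) (solve (h' ∷ d ∷ []))
      difference (inj₂ (h , hO , refl)) (inj₂ (h' , h'O , refl)) with compare h h'
      ... | less _ d    = ∈-symmetric-neg (suc (2 * h)) (suc (2 * h'))
        (even-diff (InO-InO∈evenDiffs d h'O hO refl)) (solve (h ∷ d ∷ []))
      ... | equal _     = ∈-symmetric-zero posDiffs (suc (2 * h))
      ... | greater _ d = ∈-symmetric-pos (suc (2 * h)) (suc (2 * h'))
        (even-diff (InO-InO∈evenDiffs d hO h'O refl)) (solve (h' ∷ d ∷ []))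
      difference (inj₁ (h , hE , refl)) (inj₂ (h' , h'O , refl)) with compare h h'
      ... | less _ d    = ∈-symmetric-neg (2 * h) (suc (2 * h'))
        (odd-diff (InO-minus∈oddDiffs h (suc d) h'O (sym (+-suc h d)))) (solve (h ∷ d ∷ []))
      ... | equal _     = ∈-symmetric-neg (2 * h) (suc (2 * h))
        (odd-diff (InO-minus∈oddDiffs h 0 h'O (sym (+-identityʳ h)))) (solve (h ∷ []))
      ... | greater _ d = ∈-symmetric-pos (2 * h) (suc (2 * h'))
        (odd-diff (InE-InO∈oddDiffs d hE h'O refl)) (solve (h' ∷ d ∷ []))
      difference (inj₂ (h , hO , refl)) (inj₁ (h' , h'E , refl)) with compare h h'
      ... | less _ d    = ∈-symmetric-neg (suc (2 * h)) (2 * h')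
        (odd-diff (InE-InO∈oddDiffs d h'E hO refl)) (solve (h ∷ d ∷ []))
      ... | equal _     = ∈-symmetric-pos (suc (2 * h)) (2 * h)
        (odd-diff (InO-minus∈oddDiffs h 0 hO (sym (+-identityʳ h)))) (solve (h ∷ []))
      ... | greater _ d = ∈-symmetric-pos (suc (2 * h)) (2 * h')
        (odd-diff (InO-minus∈oddDiffs h' (suc d) hO (sym (+-suc h' d)))) (solve (h' ∷ d ∷ []))

    positive-difference : ∀ {w} → w ∈ posDiffs → ∃₂ λ u v → + u ∈ A × + v ∈ A × u ≡ v + w
    positive-difference w∈ with ∈-parityUnion⁻ evenDiffs oddDiffs w∈
    ... | inj₁ (e , e∈ , refl) with evenDiffs-split e∈
    ...   | inj₁ (h , h' , hE , h'E , h≡) =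
      2 * h , 2 * h' , even∈ hE , even∈ h'E , via (cong (2 *_) h≡) (solve (h ∷ h' ∷ e ∷ []))
    ...   | inj₂ (h , h' , hO , h'O , h≡) =
      suc (2 * h) , suc (2 * h') , odd∈ hO , odd∈ h'O , via (cong (2 *_) h≡) (solve (h ∷ h' ∷ e ∷ []))
    positive-difference w∈ | inj₂ (o , o∈ , refl) with h , h' , hE , h'O , h≡ ← oddDiffs-split o∈ =
      2 * h , suc (2 * h') , even∈ hE , odd∈ h'O , via (cong (2 *_) h≡) (solve (h ∷ h' ∷ o ∷ []))

    diffs⊆⊖ : diffs ⊆ A ⊖ A
    diffs⊆⊖ (here refl) = subst (_∈ A ⊖ A) (x-x≡0 (+ 0)) (∈-cartesianProductWith⁺ ℤ._-_ (even∈ 0∈E) (even∈ 0∈E))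
    diffs⊆⊖ (there x∈) with ∈-++⁻ (map +_ posDiffs) x∈
    ... | inj₁ x∈+ with w , w∈ , refl ← ∈-map⁻ +_ x∈+ with u , v , u∈ , v∈ , u≡ ← positive-difference w∈ =
      subst (_∈ A ⊖ A) (+-minus-+ u≡) (∈-cartesianProductWith⁺ ℤ._-_ u∈ v∈)
    ... | inj₂ x∈- with w , w∈ , refl ← ∈-map⁻ (λ w → ℤ.- + w) x∈-
      with u , v , u∈ , v∈ , u≡ ← positive-difference w∈ =
      subst (_∈ A ⊖ A) (+-minus-+′ u≡) (∈-cartesianProductWith⁺ ℤ._-_ v∈ u∈)

    card-gap : ∣ A ⊕ A ∣ ≡ ∣ A ⊖ A ∣ + 1
    card-gap = begin
      ∣ A ⊕ A ∣         ≡⟨ ∣∣≡length sums-unique ⊕⊆sums sums⊆⊕ ⟩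
      length sums       ≡⟨ length-sums≡length-diffs+1 ⟩
      length diffs + 1  ≡⟨ cong (_+ 1) (∣∣≡length diffs-unique ⊖⊆diffs diffs⊆⊖) ⟨
      ∣ A ⊖ A ∣ + 1     ∎
      where open ≡-Reasoning

-- The sets A* and A

+[m*n] : ∀ m n → + m ℤ.* + n ≡ + (m * n)
+[m*n] m n = sym (ℤP.pos-* m n)

module Construction (p q : ℕ) where

  A* A X Y Z : List ℤ
  A* = Astar (suc p) (3 + q)
  A  = Aset (suc p) (3 + q)
  X  = Xset (suc p)
  Y  = Yset (suc p) (3 + q)
  Z  = Zset (suc p) (3 + q)

  m≡ : mval (suc p) (3 + q) ≡ + (2 * ((3 + q) * suc p + p))
  m≡ = begin
    + 2 ℤ.* + (4 + q) ℤ.* + suc p ℤ.- + 2  ≡⟨ cong (λ z → z ℤ.* + suc p ℤ.- + 2) (+[m*n] 2 (4 + q)) ⟩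
    + (2 * (4 + q)) ℤ.* + suc p ℤ.- + 2    ≡⟨ cong (λ z → z ℤ.- + 2) (+[m*n] (2 * (4 + q)) (suc p)) ⟩
    + (2 * (4 + q) * suc p) ℤ.- + 2        ≡⟨ +-minus-+ {2 * (4 + q) * suc p} {2} (solve (p ∷ q ∷ [])) ⟩
    + (2 * ((3 + q) * suc p + p))          ∎
    where open ≡-Reasoning

  m-2j≡ : ∀ j r → j + r ≡ p → mval (suc p) (3 + q) ℤ.- + 2 ℤ.* + j ≡ + (2 * ((3 + q) * suc p + r))
  m-2j≡ j r j+r≡p = trans (cong₂ ℤ._-_ m≡ (+[m*n] 2 j))
    (+-minus-+ {2 * ((3 + q) * suc p + p)} {2 * j} (via (cong (2 *_) (sym j+r≡p)) (solve (p ∷ q ∷ j ∷ r ∷ []))))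

  2[i+1]n-1≡ : ∀ i → + 2 ℤ.* + suc i ℤ.* + suc p ℤ.- + 1 ≡ + suc (2 * (i * suc p + p))
  2[i+1]n-1≡ i = begin
    + 2 ℤ.* + suc i ℤ.* + suc p ℤ.- + 1  ≡⟨ cong (λ z → z ℤ.* + suc p ℤ.- + 1) (+[m*n] 2 (suc i)) ⟩
    + (2 * suc i) ℤ.* + suc p ℤ.- + 1    ≡⟨ cong (λ z → z ℤ.- + 1) (+[m*n] (2 * suc i) (suc p)) ⟩
    + (2 * suc i * suc p) ℤ.- + 1        ≡⟨ +-minus-+ {2 * suc i * suc p} {1} (solve (p ∷ i ∷ [])) ⟩
    + suc (2 * (i * suc p + p))          ∎
    where open ≡-Reasoning

  m+2≡ : mval (suc p) (3 + q) ℤ.+ + 2 ≡ + (2 * ((3 + q) * suc p + suc p))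
  m+2≡ = trans (cong (ℤ._+ + 2) m≡) (cong +_ (solve (p ∷ q ∷ [])))

  ∈-X⁺ : ∀ {j} → j < suc p → + (2 * j) ∈ X
  ∈-X⁺ {j} j<n = subst (_∈ X) (+[m*n] 2 j) (∈-map⁺ (λ j → + 2 ℤ.* + j) (∈-upTo⁺ j<n))

  ∈-X⁻ : ∀ {x} → x ∈ X → ∃₂ λ j d → suc j + d ≡ suc p × x ≡ + (2 * j)
  ∈-X⁻ x∈ with j , j∈ , refl ← ∈-map⁻ (λ j → + 2 ℤ.* + j) x∈
          with d , j<n ← m≤n⇒∃[o]m+o≡n (∈-upTo⁻ j∈) = j , d , j<n , +[m*n] 2 j

  ∈-Y⁺ : ∀ j r → j + r ≡ p → + (2 * ((3 + q) * suc p + r)) ∈ Y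
  ∈-Y⁺ j r j+r≡p = subst (_∈ Y) (m-2j≡ j r j+r≡p)
    (∈-map⁺ (λ x → mval (suc p) (3 + q) ℤ.- x) (∈-map⁺ (λ j → + 2 ℤ.* + j) (∈-upTo⁺ (<-by {j} r (cong suc j+r≡p)))))

  ∈-Y⁻ : ∀ {x} → x ∈ Y → ∃₂ λ j r → suc j + r ≡ suc p × x ≡ + (2 * ((3 + q) * suc p + r))
  ∈-Y⁻ x∈ with _ , x∈X , refl ← ∈-map⁻ (λ x → mval (suc p) (3 + q) ℤ.- x) x∈
          with j , j∈ , refl ← ∈-map⁻ (λ j → + 2 ℤ.* + j) x∈X
          with r , j<n ← m≤n⇒∃[o]m+o≡n (∈-upTo⁻ j∈) = j , r , j<n , m-2j≡ j r (suc-injective j<n)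

  ∈-Z⁺ : ∀ i d → suc i + d ≡ 3 + q → + suc (2 * (i * suc p + p)) ∈ Z
  ∈-Z⁺ i d i<k = subst (_∈ Z) (2[i+1]n-1≡ i)
    (∈-map⁺ (λ i → + 2 ℤ.* + suc i ℤ.* + suc p ℤ.- + 1) (∈-upTo⁺ (<-by {i} d i<k)))

  ∈-Z⁻ : ∀ {x} → x ∈ Z → ∃₂ λ i d → suc i + d ≡ 3 + q × x ≡ + suc (2 * (i * suc p + p))
  ∈-Z⁻ x∈ with i , i∈ , refl ← ∈-map⁻ (λ i → + 2 ℤ.* + suc i ℤ.* + suc p ℤ.- + 1) {xs = upTo (3 + q)} x∈
          with d , i<k ← m≤n⇒∃[o]m+o≡n (∈-upTo⁻ i∈) = i , d , i<k , 2[i+1]n-1≡ i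

  B : List ℤ
  B = Bset (suc p) (3 + q)

  B⊆A* : B ⊆ A*
  B⊆A* = ∈-++⁺ˡ

  X⊆A* : X ⊆ A*
  X⊆A* x∈ = B⊆A* (∈-++⁺ˡ x∈)

  Y⊆A* : Y ⊆ A*
  Y⊆A* x∈ = B⊆A* (∈-++⁺ʳ X (∈-++⁺ˡ x∈))

  Z⊆A* : Z ⊆ A*
  Z⊆A* x∈ = B⊆A* (∈-++⁺ʳ X (∈-++⁺ʳ Y x∈))

  a*∈A* : + (2 * suc p) ∈ A*
  a*∈A* = ∈-++⁺ʳ B (here (+[m*n] 2 (suc p)))

  A*⊆A : A* ⊆ A
  A*⊆A = ∈-++⁺ˡ

  a∈A : + (2 * ((3 + q) * suc p + suc p)) ∈ A
  a∈A = ∈-++⁺ʳ A* (here (sym m+2≡))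

  module Realisation (b c p₀ : ℕ) (p≡1+p₀ : p ≡ suc p₀) (b+c≡1 : b + c ≡ 1) where
    open Halves p q b c p₀ p≡1+p₀ b+c≡1

    A*-split : ∀ {x} → x ∈ A* → InA x
    A*-split x∈ with ∈-++⁻ B x∈
    ... | inj₂ (here refl) = inj₁ (suc p , n∈E , +[m*n] 2 (suc p))
    ... | inj₁ x∈B with ∈-++⁻ X x∈B
    ...   | inj₁ x∈X with j , d , j<n , refl ← ∈-X⁻ x∈X = inj₁ (j , inj₁ (suc d , trans (+-suc j d) j<n) , refl)
    ...   | inj₂ x∈YZ with ∈-++⁻ Y x∈YZ
    ...     | inj₁ x∈Y with j , r , j<n , refl ← ∈-Y⁻ x∈Y =
      inj₁ ((3 + q) * suc p + r , inj₂ (r , j + b , refl , via j<n (solve (p ∷ b ∷ j ∷ r ∷ []))) , refl)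
    ...     | inj₂ x∈Z with i , d , i<k , refl ← ∈-Z⁻ x∈Z = inj₂ (i * suc p + p , (i , d , refl , i<k) , refl)

    Lower⇒∈A* : ∀ {h} → Lower h → + (2 * h) ∈ A*
    Lower⇒∈A* {h} (zero , h+0≡n) = subst (λ h → + (2 * h) ∈ A*) (trans (sym h+0≡n) (+-identityʳ h)) a*∈A*
    Lower⇒∈A* {h} (suc e , h<n) = X⊆A* (∈-X⁺ (<-by {h} e (trans (sym (+-suc h e)) h<n)))

    InO⇒∈A* : ∀ {h} → InO h → + suc (2 * h) ∈ A*
    InO⇒∈A* (i , d , refl , i<k) = Z⊆A* (∈-Z⁺ i d i<k)

  A*-realises : ∀ p₀ (p≡1+p₀ : p ≡ suc p₀) → Halves.Realises p q 0 1 p₀ p≡1+p₀ refl A*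
  A*-realises p₀ p≡1+p₀ = record
    { ∈-split = A*-split
    ; even∈   = λ { (inj₁ low) → Lower⇒∈A* low
                  ; (inj₂ (r , e , refl , r<n)) → Y⊆A* (∈-Y⁺ e r (via r<n (solve (p ∷ r ∷ e ∷ [])))) }
    ; odd∈    = InO⇒∈A*
    }
    where open Realisation 0 1 p₀ p≡1+p₀ refl

  A-realises : ∀ p₀ (p≡1+p₀ : p ≡ suc p₀) → Halves.Realises p q 1 0 p₀ p≡1+p₀ refl A
  A-realises p₀ p≡1+p₀ = record
    { ∈-split = λ x∈ → case ∈-++⁻ A* x∈ of λ
                  { (inj₁ x∈A*) → A*-split x∈A*
                  ; (inj₂ (here refl)) → inj₁ (_ , inj₂ (suc p , 0 , refl , solve (p ∷ [])) , m+2≡) }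
    ; even∈   = λ { (inj₁ low) → A*⊆A (Lower⇒∈A* low)
                  ; (inj₂ (r , zero , refl , r≡n)) →
                      subst (λ r → + (2 * ((3 + q) * suc p + r)) ∈ A) (n≡ r r≡n) a∈A
                  ; (inj₂ (r , suc e , refl , r<n)) → A*⊆A (Y⊆A* (∈-Y⁺ e r (via r<n (solve (p ∷ r ∷ e ∷ []))))) }
    ; odd∈    = λ o → A*⊆A (InO⇒∈A* o)
    }
    where
    open Realisation 1 0 p₀ p≡1+p₀ refl
    n≡ : ∀ r → suc r + 0 ≡ suc p + 1 → suc p ≡ r
    n≡ r r≡n = via (sym r≡n) (solve (p ∷ r ∷ []))

theorem5 : (n k : ℕ) → 2 ≤ n → 3 ≤ k →
    (∣ Astar n k ⊕ Astar n k ∣ ≡ ∣ Astar n k ⊖ Astar n k ∣ + 1)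
    × (∣ Aset n k ⊕ Aset n k ∣ ≡ ∣ Aset n k ⊖ Aset n k ∣ + 1)
theorem5 (suc (suc p₀)) (suc (suc (suc q))) (s≤s (s≤s z≤n)) (s≤s (s≤s (s≤s z≤n))) =
  Halves.card-gap p q 0 1 p₀ refl refl (A*-realises p₀ refl) ,
  Halves.card-gap p q 1 0 p₀ refl refl (A-realises p₀ refl)
  where
  p = suc p₀
  open Construction p q
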